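{- For any $w\in S_n$, $\deg\mathfrak{G}_w\le\#\overline{D(w)}$.
   Context: Permutations act on the right on positions ($ws_j$ swaps $w(j),w(j+1)$). $\partial_j(f)=\frac{f-s_jf}{x_j-x_{j+1}}$ ($s_jf$ swaps $x_j,x_{j+1}$), $\overline{\partial}_j(f)=\partial_j((1-x_{j+1})f)$. Grothendieck polynomials: $\mathfrak{G}_{w_0}=x_1^{n-1}\cdots x_{n-1}$ for $w_0=n\,(n-1)\cdots1$, $\mathfrak{G}_w=\overline{\partial}_j\mathfrak{G}_{ws_j}$ if $w(j)<w(j+1)$; $\deg$ is the maximal total degree of a monomial. Rothe diagram $D(w)=\{(i,j)\in[n]^2: i<w^{ -1}(j),\ j<w(i)\}$ (row $i$, column $j$). Upper closure: $\overline{D}=\{(i,j): i\le i'\text{ for some }(i',j)\in D\}$; $\#$ denotes cardinality. -}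

module Defs where

open import Data.Nat as ℕ using (ℕ; zero; suc; _+_; _*_; _∸_; _⊔_; _<ᵇ_)
open import Data.Integer as ℤ using (ℤ; +_; -_)
open import Data.List using (List; []; _∷_; _++_; map; concatMap; foldr; length; reverse; upTo; allFin; filter; cartesianProduct)
open import Data.Nat.ListAction using (sum)
open import Data.List.Properties using (≡-dec)
open import Data.Product using (_×_; _,_; ∃; proj₁; proj₂)
open import Data.Maybe using (Maybe; just; nothing)
open import Data.Bool using (if_then_else_)
open import Data.Fin using (Fin; toℕ) renaming (_<_ to _<ᶠ_; _≤_ to _≤ᶠ_)
open import Data.Fin.Properties using (any?) renaming (_<?_ to _<ᶠ?_; _≤?_ to _≤ᶠ?_)
open import Data.Fin.Permutation using (Permutation′; _⟨$⟩ʳ_; _⟨$⟩ˡ_)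
open import Relation.Nullary using (Dec; yes; no)
open import Relation.Nullary.Decidable using (_×-dec_)

-- A monomial is its exponent vector (a list of length n; position k,
-- 0-based, is the exponent of x_{k+1}).  A polynomial is a list of
-- (coefficient , monomial) terms; `normalize` collects like terms and
-- drops zero coefficients, so a normalized polynomial lists each
-- monomial with nonzero coefficient exactly once.

Mono : Set
Mono = List ℕ

Poly : Set
Poly = List (ℤ × Mono)

at : ℕ → Mono → ℕ
at _ [] = 0
at zero (a ∷ _) = a
at (suc k) (_ ∷ m) = at k m

set : ℕ → ℕ → Mono → Mono
set _ _ [] = []
set zero v (_ ∷ m) = v ∷ m
set (suc k) v (a ∷ m) = a ∷ set k v m

consNZ : ℤ → Mono → Poly → Poly
consNZ c m p with c ℤ.≟ + 0
... | yes _ = p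
... | no _ = (c , m) ∷ p

insertTerm : ℤ → Mono → Poly → Poly
insertTerm c m [] = consNZ c m []
insertTerm c m ((d , m') ∷ p) with ≡-dec ℕ._≟_ m m'
... | yes _ = consNZ (c ℤ.+ d) m' p
... | no _ = (d , m') ∷ insertTerm c m p

normalize : Poly → Poly
normalize = foldr (λ t acc → insertTerm (proj₁ t) (proj₂ t) acc) []

-- Divided differences.  Positions are 0-based: `j` here is the paper's
-- index j+1, i.e. ∂ j acts on the variables at positions j and j+1.
--
-- On a term c·x^m with p = m_j, q = m_{j+1} the exact quotient
--   (x^m - s_j x^m)/(x_j - x_{j+1})
-- is  Σ_{k<p-q} c·x_j^{p-1-k} x_{j+1}^{q+k}            if p > q,
--    -Σ_{k<q-p} c·x_j^{q-1-k} x_{j+1}^{p+k}            if q > p,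
--     0                                                if p = q
-- (exactly one of the two sums below is nonempty, by truncated subtraction).

divDiffTerm : ℕ → ℤ × Mono → Poly
divDiffTerm j (c , m) =
  map (λ k → (c , set j (p ∸ 1 ∸ k) (set (suc j) (q + k) m))) (upTo (p ∸ q))
  ++ map (λ k → (- c , set j (q ∸ 1 ∸ k) (set (suc j) (p + k) m))) (upTo (q ∸ p))
  where
  p = at j m
  q = at (suc j) m

∂ : ℕ → Poly → Poly
∂ j f = normalize (concatMap (divDiffTerm j) f)

oneMinusX : ℕ → Poly → Poly
oneMinusX j f = normalize (concatMap
  (λ t → (proj₁ t , proj₂ t) ∷ (- proj₁ t , set (suc j) (suc (at (suc j) (proj₂ t))) (proj₂ t)) ∷ [])
  f)

∂̄ : ℕ → Poly → Poly
∂̄ j f = ∂ j (oneMinusX j f)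

-- Permutations in one-line notation with 0-based values.

oneLine : {n : ℕ} → Permutation′ n → List ℕ
oneLine w = map (λ i → toℕ (w ⟨$⟩ʳ i)) (allFin _)

w₀ : ℕ → List ℕ
w₀ n = reverse (upTo n)

-- right multiplication by s_j: swap the entries at positions j, j+1
swapAt : ℕ → List ℕ → List ℕ
swapAt zero (a ∷ b ∷ w) = b ∷ a ∷ w
swapAt (suc j) (a ∷ w) = a ∷ swapAt j w
swapAt _ w = w

firstAscent : List ℕ → Maybe ℕ
firstAscent (a ∷ b ∷ w) =
  if a <ᵇ b then just 0 else Data.Maybe.map suc (firstAscent (b ∷ w))
  where import Data.Maybe
firstAscent _ = nothing

-- Grothendieck polynomials:  G_{w₀} = x_1^{n-1} ⋯ x_{n-1},
-- G_w = ∂̄_j G_{w s_j} for an ascent j of w (we use the first one).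
-- `fuel` bounds the recursion (number of inversions grows by one each
-- step, so n*n steps always suffice).

grothFuel : ℕ → ℕ → List ℕ → Poly
grothFuel n fuel w with ≡-dec ℕ._≟_ w (w₀ n)
... | yes _ = (+ 1 , w₀ n) ∷ []
... | no _ with firstAscent w | fuel
...   | just j | suc f = ∂̄ j (grothFuel n f (swapAt j w))
...   | _      | _     = []

grothendieck : (n : ℕ) → Permutation′ n → Poly
grothendieck n w = grothFuel n (n * n) (oneLine w)

deg : Poly → ℕ
deg f = foldr (λ t acc → sum (proj₂ t) ⊔ acc) 0 (normalize f)

InRothe : {n : ℕ} → Permutation′ n → Fin n → Fin n → Set
InRothe w i j = (i <ᶠ w ⟨$⟩ˡ j) × (j <ᶠ w ⟨$⟩ʳ i)

InUpperClosure : {n : ℕ} → Permutation′ n → Fin n → Fin n → Set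
InUpperClosure w i j = ∃ λ i' → (i ≤ᶠ i') × InRothe w i' j

inUpperClosure? : {n : ℕ} (w : Permutation′ n) (i j : Fin n) → Dec (InUpperClosure w i j)
inUpperClosure? w i j =
  any? λ i' → (i ≤ᶠ? i') ×-dec ((i' <ᶠ? (w ⟨$⟩ˡ j)) ×-dec (j <ᶠ? (w ⟨$⟩ʳ i')))

upperClosureSize : {n : ℕ} → Permutation′ n → ℕ
upperClosureSize {n} w =
  length (filter (λ ij → inUpperClosure? w (proj₁ ij) (proj₂ ij))
                 (cartesianProduct (allFin n) (allFin n)))

module Submission where

-- Every monomial x^m of 𝔊_w satisfies m_i ≤ β(w)_i, where β(w)_i counts the p > i for which
-- w(p) < max(w(i), …, w(p−1)).  For w₀ this is an equality.  In 𝔊_w = ∂̄_j 𝔊_{ws_j}, multiplying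
-- by 1 − x_{j+1} raises the exponent of x_{j+1} by one and ∂_j then pushes both exponents of
-- x_j, x_{j+1} below their maximum; this matches β(ws_j)_j = β(w)_j + 1 and
-- β(ws_j)_{j+1} ≤ β(w)_j = β(w)_{j+1}, while β is unchanged elsewhere when j is the first ascent.
-- Each p counted in β(w)_i yields the cell (i, w(p)) of the upper closure of D(w), witnessed by
-- the position q < p of that maximum, and distinct p give distinct cells; so Σ β(w) ≤ #D̄(w).

open import Defs
open import Data.Empty using (⊥-elim)
open import Data.Bool using (true; false; T)
open import Data.Fin using (Fin; toℕ) renaming (_<_ to _<ᶠ_; _≤_ to _≤ᶠ_)
open import Data.Fin.Properties using (toℕ-injective) renaming (_≟_ to _≟ᶠ_; <⇒≢ to <ᶠ⇒≢)
open import Data.Fin.Permutation using (Permutation′; _⟨$⟩ʳ_; _⟨$⟩ˡ_; inverseˡ)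
open import Data.Integer as ℤ using (+_)
open import Data.List using (List; []; _∷_; _++_; map; concatMap; foldr; length; filter; allFin; upTo; downFrom; cartesianProduct)
open import Data.List.Membership.Propositional.Properties using (∈-upTo⁻; ∈-filter⁺; ∈-allFin)
open import Data.List.Properties using (≡-dec; reverse-upTo; length-++; filter-++; filter-notAll)
open import Data.List.Relation.Binary.Subset.Propositional using (_⊆_)
open import Data.List.Relation.Unary.All as All using (All; []; _∷_)
open import Data.List.Relation.Unary.All.Properties using (++⁺; map⁺; concat⁺)
open import Data.List.Relation.Unary.AllPairs as AllPairs using (AllPairs; []; _∷_)
open import Data.List.Relation.Unary.AllPairs.Properties using (tabulate⁺-<)
open import Data.List.Relation.Unary.Any as Any using (here; there)
open import Data.List.Relation.Unary.Unique.Propositional using (Unique)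
open import Data.Maybe using (just; nothing)
open import Data.Nat as ℕ using (ℕ; zero; suc; _+_; _*_; _∸_; _≤_; _<_; _⊔_; z≤n; s≤s; _<ᵇ_)
open import Data.Nat.ListAction using (sum)
open import Data.Nat.Properties
open import Data.Sum using ([_,_]′)
open import Data.Product using (_×_; _,_; proj₁; proj₂)
open import Function using (_∘_; id)
open import Relation.Binary.Definitions using (DecidableEquality)
open import Relation.Binary.PropositionalEquality
open import Relation.Nullary using (yes; no; ¬?; does)
open import Relation.Unary using (Decidable; _∩_)

AllMonomials : (Mono → Set) → Poly → Set
AllMonomials P = All (P ∘ proj₂)

module _ {P : Mono → Set} where

  consNZ-preserves : ∀ c {m} p → P m → AllMonomials P p → AllMonomials P (consNZ c m p)
  consNZ-preserves c p Pm Pp with c ℤ.≟ + 0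
  ... | yes _ = Pp
  ... | no _  = Pm ∷ Pp

  insertTerm-preserves : ∀ c {m} p → P m → AllMonomials P p → AllMonomials P (insertTerm c m p)
  insertTerm-preserves c [] Pm [] = consNZ-preserves c [] Pm []
  insertTerm-preserves c {m} ((d , m′) ∷ p) Pm (Pm′ ∷ Pp) with ≡-dec ℕ._≟_ m m′
  ... | yes _ = consNZ-preserves (c ℤ.+ d) p Pm′ Pp
  ... | no _  = Pm′ ∷ insertTerm-preserves c p Pm Pp

  normalize-preserves : ∀ {f} → AllMonomials P f → AllMonomials P (normalize f)
  normalize-preserves []        = []
  normalize-preserves (Pm ∷ Pf) = insertTerm-preserves _ _ Pm (normalize-preserves Pf)

concatMap-preserves : {A B : Set} {P : A → Set} {Q : B → Set} {g : A → List B} →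
                      (∀ {x} → P x → All Q (g x)) → ∀ {xs} → All P xs → All Q (concatMap g xs)
concatMap-preserves h = concat⁺ ∘ map⁺ ∘ All.map h

at-set-≢ : ∀ {k i} v m → k ≢ i → at k (set i v m) ≡ at k m
at-set-≢                 v []      _   = refl
at-set-≢ {zero}  {zero}  v (a ∷ m) k≢i = ⊥-elim (k≢i refl)
at-set-≢ {zero}  {suc i} v (a ∷ m) _   = refl
at-set-≢ {suc k} {zero}  v (a ∷ m) _   = refl
at-set-≢ {suc k} {suc i} v (a ∷ m) k≢i = at-set-≢ v m (k≢i ∘ cong suc)

at-set-≤ : ∀ i v m → at i (set i v m) ≤ v
at-set-≤ i       v []      = z≤n
at-set-≤ zero    v (a ∷ m) = ≤-refl
at-set-≤ (suc i) v (a ∷ m) = at-set-≤ i v m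

Bounded : (ℕ → ℕ) → Mono → Set
Bounded β m = ∀ k → at k m ≤ β k

BoundedOff : ℕ → (ℕ → ℕ) → Mono → Set
BoundedOff j β m = ∀ k → k ≢ j → k ≢ suc j → at k m ≤ β k

PairBounded : ℕ → ℕ → Mono → Set
PairBounded j R m = at j m ≤ R × at (suc j) m ≤ R

<∸⇒+< : ∀ q {p k} → k < p ∸ q → q + k < p
<∸⇒+< zero    {p}     k<p∸q = k<p∸q
<∸⇒+< (suc q) {suc p} k<p∸q = s≤s (<∸⇒+< q k<p∸q)

-- p ∸ 1 ∸ k and q + k are the exponents of x_j and x_{j+1} in the k-th term of divDiffTerm.
divDiff-exponents-≤ : ∀ {R p q k} → k < p ∸ q → p ≤ suc R → p ∸ 1 ∸ k ≤ R × q + k ≤ R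
divDiff-exponents-≤ {R} {p} {q} {k} k<p∸q p≤1+R =
  ≤-trans (m∸n≤m (p ∸ 1) k) (∸-monoˡ-≤ 1 p≤1+R) ,
  m<1+n⇒m≤n (<-≤-trans (<∸⇒+< q k<p∸q) p≤1+R)

module _ {j : ℕ} {β : ℕ → ℕ} where

  set-pair-bounded : ∀ {R a b m} → BoundedOff j β m → a ≤ R → b ≤ R →
                     (BoundedOff j β ∩ PairBounded j R) (set j a (set (suc j) b m))
  set-pair-bounded {R} {a} {b} {m} off a≤R b≤R =
    (λ k k≢j k≢1+j → subst (_≤ β k) (sym (trans (at-set-≢ a m′ k≢j) (at-set-≢ b m k≢1+j))) (off k k≢j k≢1+j)) ,
    ≤-trans (at-set-≤ j a m′) a≤R ,
    subst (_≤ R) (sym (at-set-≢ a m′ 1+n≢n)) (≤-trans (at-set-≤ (suc j) b m) b≤R)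
    where m′ = set (suc j) b m

  divDiffTerm-bounded : ∀ {R} c {m} → BoundedOff j β m → PairBounded j (suc R) m →
                        AllMonomials (BoundedOff j β ∩ PairBounded j R) (divDiffTerm j (c , m))
  divDiffTerm-bounded {R} c {m} off (p≤1+R , q≤1+R) =
    ++⁺ (half {c} {q = at (suc j) m} p≤1+R) (half {ℤ.- c} {q = at j m} q≤1+R)
    where
    half : ∀ {c′ p q} → p ≤ suc R →
           AllMonomials (BoundedOff j β ∩ PairBounded j R)
                        (map (λ k → (c′ , set j (p ∸ 1 ∸ k) (set (suc j) (q + k) m))) (upTo (p ∸ q)))
    half p≤1+R = map⁺ (All.tabulate λ k∈ →
      let (a≤R , b≤R) = divDiff-exponents-≤ (∈-upTo⁻ k∈) p≤1+R in set-pair-bounded {m = m} off a≤R b≤R)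

  oneMinusX-term-bounded : ∀ {R} → β j ≤ suc R → β (suc j) ≤ R → ∀ {c m} → Bounded β m →
    AllMonomials (BoundedOff j β ∩ PairBounded j (suc R))
                 ((c , m) ∷ (ℤ.- c , set (suc j) (suc (at (suc j) m)) m) ∷ [])
  oneMinusX-term-bounded {R} βj≤1+R β1+j≤R {m = m} bnd =
    ((λ k _ _ → bnd k) , ≤-trans (bnd j) βj≤1+R , m≤n⇒m≤1+n (≤-trans (bnd (suc j)) β1+j≤R)) ∷
    ((λ k _ k≢1+j → subst (_≤ β k) (sym (at-set-≢ _ m k≢1+j)) (bnd k)) ,
     subst (_≤ suc R) (sym (at-set-≢ _ m (1+n≢n ∘ sym))) (≤-trans (bnd j) βj≤1+R) ,
     ≤-trans (at-set-≤ (suc j) _ m) (s≤s (≤-trans (bnd (suc j)) β1+j≤R))) ∷ []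

  ∂̄-bounded : ∀ {R f} → β j ≤ suc R → β (suc j) ≤ R → AllMonomials (Bounded β) f →
              AllMonomials (BoundedOff j β ∩ PairBounded j R) (∂̄ j f)
  ∂̄-bounded βj≤1+R β1+j≤R =
    normalize-preserves ∘
    concatMap-preserves (λ {t} (off , pb) → divDiffTerm-bounded (proj₁ t) {proj₂ t} off pb) ∘
    normalize-preserves ∘ concatMap-preserves (oneMinusX-term-bounded βj≤1+R β1+j≤R)

nonRecords : ℕ → List ℕ → ℕ
nonRecords t []       = 0
nonRecords t (y ∷ ys) with t <? y
... | yes _ = nonRecords y ys
... | no _  = suc (nonRecords t ys)

nonRecords-< : ∀ {t y} ys → t < y → nonRecords t (y ∷ ys) ≡ nonRecords y ys
nonRecords-< {t} {y} ys t<y with t <? y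
... | yes _   = refl
... | no t≮y = ⊥-elim (t≮y t<y)

nonRecords-≤ : ∀ {t y} ys → y ≤ t → nonRecords t (y ∷ ys) ≡ suc (nonRecords t ys)
nonRecords-≤ {t} {y} ys y≤t with t <? y
... | yes t<y = ⊥-elim (<⇒≱ t<y y≤t)
... | no _    = refl

nonRecords-mono : ∀ {s t} ys → s ≤ t → nonRecords s ys ≤ nonRecords t ys
nonRecords-mono []       _   = z≤n
nonRecords-mono {s} {t} (y ∷ ys) s≤t with s <? y | t <? y
... | yes _   | yes _   = ≤-refl
... | no s≮y  | yes t<y = ⊥-elim (s≮y (≤-<-trans s≤t t<y))
... | yes _   | no t≮y  = m≤n⇒m≤1+n (nonRecords-mono ys (≮⇒≥ t≮y))
... | no _    | no _    = s≤s (nonRecords-mono ys s≤t)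

nonRecords-downFrom : ∀ {t} m → m ≤ t → nonRecords t (downFrom m) ≡ m
nonRecords-downFrom zero    _     = refl
nonRecords-downFrom (suc m) m<t =
  trans (nonRecords-≤ (downFrom m) (<⇒≤ m<t)) (cong suc (nonRecords-downFrom m (<⇒≤ m<t)))

exponentBound : List ℕ → List ℕ
exponentBound []       = []
exponentBound (x ∷ xs) = nonRecords x xs ∷ exponentBound xs

exponentBound-downFrom : ∀ m → exponentBound (downFrom m) ≡ downFrom m
exponentBound-downFrom zero    = refl
exponentBound-downFrom (suc m) = cong₂ _∷_ (nonRecords-downFrom m ≤-refl) (exponentBound-downFrom m)

exponentBound-w₀ : ∀ n → exponentBound (w₀ n) ≡ w₀ n
exponentBound-w₀ n rewrite reverse-upTo n = exponentBound-downFrom n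

data FirstAscent : ℕ → List ℕ → Set where
  here  : ∀ {a b xs}   → a < b → FirstAscent 0 (a ∷ b ∷ xs)
  there : ∀ {a b xs j} → b ≤ a → FirstAscent j (b ∷ xs) → FirstAscent (suc j) (a ∷ b ∷ xs)

firstAscent-sound : ∀ {j} xs → firstAscent xs ≡ just j → FirstAscent j xs
firstAscent-sound (a ∷ b ∷ xs) eq with a <ᵇ b in a<ᵇb
firstAscent-sound (a ∷ b ∷ xs) refl | true = here (<ᵇ⇒< a b (subst T (sym a<ᵇb) _))
firstAscent-sound (a ∷ b ∷ xs) eq   | false with firstAscent (b ∷ xs) in ascent
firstAscent-sound (a ∷ b ∷ xs) refl | false | just _ =
  there (≮⇒≥ (λ a<b → subst T a<ᵇb (<⇒<ᵇ a<b))) (firstAscent-sound (b ∷ xs) ascent)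

-- Here the ascent must be the first one: all entries before it are at most y ≤ t,
-- so they are non-records and swapping does not change the records above t.
nonRecords-swap : ∀ {j t y ys} → FirstAscent j (y ∷ ys) → y ≤ t →
                  nonRecords t (swapAt j (y ∷ ys)) ≡ nonRecords t (y ∷ ys)
nonRecords-swap {t = t} {y} {b ∷ zs} (here y<b) y≤t = [ t<b , b≤t ]′ (<-≤-connex t b)
  where
  open ≡-Reasoning
  rhs : nonRecords t (y ∷ b ∷ zs) ≡ suc (nonRecords t (b ∷ zs))
  rhs = nonRecords-≤ (b ∷ zs) y≤t
  t<b : t < b → nonRecords t (b ∷ y ∷ zs) ≡ nonRecords t (y ∷ b ∷ zs)
  t<b t<b = begin
    nonRecords t (b ∷ y ∷ zs)     ≡⟨ nonRecords-< (y ∷ zs) t<b ⟩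
    nonRecords b (y ∷ zs)         ≡⟨ nonRecords-≤ zs (<⇒≤ y<b) ⟩
    suc (nonRecords b zs)         ≡⟨ cong suc (nonRecords-< zs t<b) ⟨
    suc (nonRecords t (b ∷ zs))   ≡⟨ rhs ⟨
    nonRecords t (y ∷ b ∷ zs)     ∎
  b≤t : b ≤ t → nonRecords t (b ∷ y ∷ zs) ≡ nonRecords t (y ∷ b ∷ zs)
  b≤t b≤t = begin
    nonRecords t (b ∷ y ∷ zs)        ≡⟨ nonRecords-≤ (y ∷ zs) b≤t ⟩
    suc (nonRecords t (y ∷ zs))      ≡⟨ cong suc (nonRecords-≤ zs y≤t) ⟩
    suc (suc (nonRecords t zs))      ≡⟨ cong suc (nonRecords-≤ zs b≤t) ⟨
    suc (nonRecords t (b ∷ zs))      ≡⟨ rhs ⟨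
    nonRecords t (y ∷ b ∷ zs)        ∎
nonRecords-swap {j = suc j} {y = y} {b ∷ zs} (there b≤y ascent) y≤t =
  trans (nonRecords-≤ (swapAt j (b ∷ zs)) y≤t)
        (trans (cong suc (nonRecords-swap ascent (≤-trans b≤y y≤t))) (sym (nonRecords-≤ (b ∷ zs) y≤t)))

boundAt : List ℕ → ℕ → ℕ
boundAt xs k = at k (exponentBound xs)

boundAt-swap-ascent : ∀ {j xs} → FirstAscent j xs → boundAt (swapAt j xs) j ≡ suc (boundAt xs j)
boundAt-swap-ascent {xs = a ∷ b ∷ xs} (here a<b) =
  trans (nonRecords-≤ xs (<⇒≤ a<b)) (cong suc (sym (nonRecords-< xs a<b)))
boundAt-swap-ascent (there _ ascent) = boundAt-swap-ascent ascent

boundAt-swap-next : ∀ {j xs} → FirstAscent j xs → boundAt (swapAt j xs) (suc j) ≤ boundAt xs j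
boundAt-swap-next {xs = a ∷ b ∷ xs} (here a<b) =
  subst (nonRecords a xs ≤_) (sym (nonRecords-< xs a<b)) (nonRecords-mono xs (<⇒≤ a<b))
boundAt-swap-next (there _ ascent) = boundAt-swap-next ascent

boundAt-ascent : ∀ {j xs} → FirstAscent j xs → boundAt xs (suc j) ≡ boundAt xs j
boundAt-ascent {xs = a ∷ b ∷ xs} (here a<b) = sym (nonRecords-< xs a<b)
boundAt-ascent (there _ ascent) = boundAt-ascent ascent

boundAt-swap-off : ∀ {j xs k} → FirstAscent j xs → k ≢ j → k ≢ suc j →
                   boundAt (swapAt j xs) k ≡ boundAt xs k
boundAt-swap-off {k = zero}        (here _)  k≢j _     = ⊥-elim (k≢j refl)
boundAt-swap-off {k = suc zero}    (here _)  _   k≢1+j = ⊥-elim (k≢1+j refl)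
boundAt-swap-off {k = suc (suc k)} (here _)  _   _     = refl
boundAt-swap-off {k = zero}        (there b≤a ascent) _ _ = nonRecords-swap ascent b≤a
boundAt-swap-off {k = suc k}       (there _ ascent) k≢j k≢1+j =
  boundAt-swap-off ascent (k≢j ∘ cong suc) (k≢1+j ∘ cong suc)

exchange-bounded : ∀ {j xs m} → FirstAscent j xs →
                   (BoundedOff j (boundAt (swapAt j xs)) ∩ PairBounded j (boundAt xs j)) m →
                   Bounded (boundAt xs) m
exchange-bounded {j} ascent (off , mj≤ , m1+j≤) k with k ℕ.≟ j | k ℕ.≟ suc j
... | yes refl | _        = mj≤
... | no _     | yes refl = subst (_ ≤_) (sym (boundAt-ascent ascent)) m1+j≤
... | no k≢j   | no k≢1+j = subst (_ ≤_) (boundAt-swap-off ascent k≢j k≢1+j) (off k k≢j k≢1+j)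

grothFuel-bounded : ∀ n fuel xs → AllMonomials (Bounded (boundAt xs)) (grothFuel n fuel xs)
grothFuel-bounded n fuel xs with ≡-dec ℕ._≟_ xs (w₀ n)
... | yes refl = (λ k → ≤-reflexive (cong (at k) (sym (exponentBound-w₀ n)))) ∷ []
... | no _ with firstAscent xs in ascent | fuel
...   | just j  | suc fuel′ =
  All.map (λ {t} → exchange-bounded {m = proj₂ t} first)
          (∂̄-bounded (≤-reflexive (boundAt-swap-ascent first)) (boundAt-swap-next first)
                     (grothFuel-bounded n fuel′ (swapAt j xs)))
  where first = firstAscent-sound xs ascent
...   | just _  | zero = []
...   | nothing | _    = []

sum-≤-pointwise : ∀ m b → Bounded (λ k → at k b) m → sum m ≤ sum b
sum-≤-pointwise []      b        _ = z≤n
sum-≤-pointwise (x ∷ m) []       m≤b = +-mono-≤ (m≤b 0) (sum-≤-pointwise m [] (m≤b ∘ suc))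
sum-≤-pointwise (x ∷ m) (y ∷ b)  m≤b = +-mono-≤ (m≤b 0) (sum-≤-pointwise m b (m≤b ∘ suc))

deg-≤ : ∀ {S f} → AllMonomials (λ m → sum m ≤ S) f → deg f ≤ S
deg-≤ = foldr-⊔-≤ ∘ normalize-preserves
  where
  foldr-⊔-≤ : ∀ {S g} → AllMonomials (λ m → sum m ≤ S) g → foldr (λ t acc → sum (proj₂ t) ⊔ acc) 0 g ≤ S
  foldr-⊔-≤ []       = z≤n
  foldr-⊔-≤ (p ∷ ps) = ⊔-lub p (foldr-⊔-≤ ps)

deg-grothFuel : ∀ n fuel xs → deg (grothFuel n fuel xs) ≤ sum (exponentBound xs)
deg-grothFuel n fuel xs =
  deg-≤ (All.map (λ {t} → sum-≤-pointwise (proj₂ t) (exponentBound xs)) (grothFuel-bounded n fuel xs))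

unique-⊆⇒length≤ : {A : Set} → DecidableEquality A → {xs ys : List A} →
                    Unique xs → xs ⊆ ys → length xs ≤ length ys
unique-⊆⇒length≤ _≟_ {[]}     _                _     = z≤n
unique-⊆⇒length≤ _≟_ {x ∷ xs} {ys} (x∉xs ∷ uxs) xs⊆ys = begin-strict
  length xs                ≤⟨ unique-⊆⇒length≤ _≟_ uxs tail⊆ ⟩
  length (filter ≢x? ys)   <⟨ filter-notAll ≢x? ys (Any.map (λ x≡y y≢x → y≢x (sym x≡y)) (xs⊆ys (here refl))) ⟩
  length ys                ∎
  where
  open ≤-Reasoning
  ≢x? = λ y → ¬? (y ≟ x)
  tail⊆ : xs ⊆ filter ≢x? ys
  tail⊆ y∈xs = ∈-filter⁺ ≢x? (xs⊆ys (there y∈xs)) (All.lookup x∉xs y∈xs ∘ sym)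

length-filter-map : {A B : Set} {P : B → Set} (P? : Decidable P) (f : A → B) (xs : List A) →
                    length (filter P? (map f xs)) ≡ length (filter (P? ∘ f) xs)
length-filter-map P? f []       = refl
length-filter-map P? f (x ∷ xs) with does (P? (f x))
... | true  = cong suc (length-filter-map P? f xs)
... | false = length-filter-map P? f xs

length-filter-cartesianProduct : {A B : Set} {P : A × B → Set} (P? : Decidable P) (xs : List A) (ys : List B) →
  length (filter P? (cartesianProduct xs ys)) ≡ sum (map (λ x → length (filter (P? ∘ (x ,_)) ys)) xs)
length-filter-cartesianProduct P? []       ys = refl
length-filter-cartesianProduct P? (x ∷ xs) ys = begin
  length (filter P? (map (x ,_) ys ++ cartesianProduct xs ys))
    ≡⟨ cong length (filter-++ P? (map (x ,_) ys) _) ⟩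
  length (filter P? (map (x ,_) ys) ++ filter P? (cartesianProduct xs ys))
    ≡⟨ length-++ (filter P? (map (x ,_) ys)) ⟩
  length (filter P? (map (x ,_) ys)) + length (filter P? (cartesianProduct xs ys))
    ≡⟨ cong₂ _+_ (length-filter-map P? (x ,_) ys) (length-filter-cartesianProduct P? xs ys) ⟩
  length (filter (P? ∘ (x ,_)) ys) + sum (map (λ x → length (filter (P? ∘ (x ,_)) ys)) xs) ∎
  where open ≡-Reasoning

module _ {n : ℕ} (w : Permutation′ n) where

  value : Fin n → ℕ
  value p = toℕ (w ⟨$⟩ʳ p)

  value-injective : ∀ {p q} → value p ≡ value q → p ≡ q
  value-injective {p} {q} eq = begin
    p                        ≡⟨ inverseˡ w ⟨
    w ⟨$⟩ˡ (w ⟨$⟩ʳ p)        ≡⟨ cong (w ⟨$⟩ˡ_) (toℕ-injective eq) ⟩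
    w ⟨$⟩ˡ (w ⟨$⟩ʳ q)        ≡⟨ inverseˡ w ⟩
    q                        ∎
    where open ≡-Reasoning

  nonRecordColumns : ℕ → List (Fin n) → List (Fin n)
  nonRecordColumns t []       = []
  nonRecordColumns t (p ∷ ps) with t <? value p
  ... | yes _ = nonRecordColumns (value p) ps
  ... | no _  = (w ⟨$⟩ʳ p) ∷ nonRecordColumns t ps

  length-nonRecordColumns : ∀ t ps → length (nonRecordColumns t ps) ≡ nonRecords t (map value ps)
  length-nonRecordColumns t []       = refl
  length-nonRecordColumns t (p ∷ ps) with t <? value p
  ... | yes _ = length-nonRecordColumns (value p) ps
  ... | no _  = cong suc (length-nonRecordColumns t ps)

  nonRecordColumns-all : ∀ {P : Fin n → Set} t {ps} → All (P ∘ (w ⟨$⟩ʳ_)) ps → All P (nonRecordColumns t ps)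
  nonRecordColumns-all t []         = []
  nonRecordColumns-all t {p ∷ ps} (Pp ∷ Pps) with t <? value p
  ... | yes _ = nonRecordColumns-all (value p) Pps
  ... | no _  = Pp ∷ nonRecordColumns-all t Pps

  nonRecordColumns-unique : ∀ t {ps} → Unique ps → Unique (nonRecordColumns t ps)
  nonRecordColumns-unique t {[]}     []             = []
  nonRecordColumns-unique t {p ∷ ps} (p∉ps ∷ uniq) with t <? value p
  ... | yes _ = nonRecordColumns-unique (value p) uniq
  ... | no _  = nonRecordColumns-all t (All.map (λ p≢q wp≡wq → p≢q (value-injective (cong toℕ wp≡wq))) p∉ps)
              ∷ nonRecordColumns-unique t uniq

  -- The position q of the running maximum witnesses every non-record column.
  nonRecordColumns-inUpperClosure : ∀ {i q ps} → i ≤ᶠ q → All (q <ᶠ_) ps → AllPairs _<ᶠ_ ps →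
                                    All (InUpperClosure w i) (nonRecordColumns (value q) ps)
  nonRecordColumns-inUpperClosure {ps = []} _ [] [] = []
  nonRecordColumns-inUpperClosure {i} {q} {p ∷ ps} i≤q (q<p ∷ q<ps) (p<ps ∷ sorted) with value q <? value p
  ... | yes _   = nonRecordColumns-inUpperClosure (≤-trans i≤q (<⇒≤ q<p)) p<ps sorted
  ... | no wq≮wp =
    (q , i≤q , subst (q <ᶠ_) (sym (inverseˡ w)) q<p , wp<wq) ∷ nonRecordColumns-inUpperClosure i≤q q<ps sorted
    where
    wp<wq : value p < value q
    wp<wq = ≤∧≢⇒< (≮⇒≥ wq≮wp) (λ wp≡wq → <⇒≢ q<p (cong toℕ (value-injective (sym wp≡wq))))

  rowSize : Fin n → ℕ
  rowSize i = length (filter (inUpperClosure? w i) (allFin n))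

  nonRecords-≤-rowSize : ∀ {p ps} → AllPairs _<ᶠ_ (p ∷ ps) → nonRecords (value p) (map value ps) ≤ rowSize p
  nonRecords-≤-rowSize {p} {ps} (p<ps ∷ sorted) = begin
    nonRecords (value p) (map value ps)   ≡⟨ length-nonRecordColumns (value p) ps ⟨
    length (nonRecordColumns (value p) ps) ≤⟨ unique-⊆⇒length≤ _≟ᶠ_ (nonRecordColumns-unique (value p) unique) ⊆row ⟩
    rowSize p                             ∎
    where
    open ≤-Reasoning
    unique : Unique ps
    unique = AllPairs.map <ᶠ⇒≢ sorted
    ⊆row : nonRecordColumns (value p) ps ⊆ filter (inUpperClosure? w p) (allFin n)
    ⊆row c∈ = ∈-filter⁺ (inUpperClosure? w p) (∈-allFin _)
                (All.lookup (nonRecordColumns-inUpperClosure ≤-refl p<ps sorted) c∈)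

  sum-exponentBound-≤ : ∀ {ps} → AllPairs _<ᶠ_ ps → sum (exponentBound (map value ps)) ≤ sum (map rowSize ps)
  sum-exponentBound-≤ []                = z≤n
  sum-exponentBound-≤ sorted@(_ ∷ tail) = +-mono-≤ (nonRecords-≤-rowSize sorted) (sum-exponentBound-≤ tail)

  sum-exponentBound-≤-upperClosureSize : sum (exponentBound (oneLine w)) ≤ upperClosureSize w
  sum-exponentBound-≤-upperClosureSize = begin
    sum (exponentBound (oneLine w))   ≤⟨ sum-exponentBound-≤ (tabulate⁺-< id) ⟩
    sum (map rowSize (allFin n))      ≡⟨ length-filter-cartesianProduct _ (allFin n) (allFin n) ⟨
    upperClosureSize w                ∎
    where open ≤-Reasoning

corollary6p5 : (n : ℕ) (w : Permutation′ n) → deg (grothendieck n w) ≤ upperClosureSize w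
corollary6p5 n w = begin
  deg (grothendieck n w)             ≤⟨ deg-grothFuel n (n * n) (oneLine w) ⟩
  sum (exponentBound (oneLine w))    ≤⟨ sum-exponentBound-≤-upperClosureSize w ⟩
  upperClosureSize w                 ∎
  where open ≤-Reasoning
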